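{- If $G$ is a $4$-regular graph, then $\mathrm{TC}_2(G)=4$.
   Context: All graphs are finite, simple and connected. For a vertex $v$, $N(v)$ denotes its open neighborhood. A set $S\subseteq V(G)$ is a total $2$-dominating set if $|N(v)\cap S|\ge 2$ for every $v\in V(G)$. Two disjoint sets $U,W\subseteq V(G)$ form a total $2$-coalition if neither is a total $2$-dominating set but $U\cup W$ is. A total $2$-coalition partition of $G$ is a partition $\Omega$ of $V(G)$ such that every set of $\Omega$ forms a total $2$-coalition with some other set of $\Omega$. $\mathrm{TC}_2(G)$ is the maximum cardinality of a total $2$-coalition partition of $G$. -}

module Defs where

open import Data.Nat using (ℕ; _≤_)
open import Data.Bool using (Bool; true; false)
open import Data.Fin using (Fin; _≟_)
open import Data.Fin.Subset using (Subset; _∩_; _∪_; ∣_∣; ⊥)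
open import Data.Vec using (tabulate)
open import Data.Product using (Σ; ∃; _×_; Σ-syntax)
open import Function using (Surjective)
open import Relation.Nullary using (¬_)
open import Relation.Nullary.Decidable using (⌊_⌋)
open import Relation.Binary.PropositionalEquality using (_≡_; _≢_)

record Graph (n : ℕ) : Set where
  field
    adj    : Fin n → Fin n → Bool
    sym    : ∀ u v → adj u v ≡ adj v u
    irrefl : ∀ v → adj v v ≡ false
open Graph public

module _ {n : ℕ} (G : Graph n) where

  N : Fin n → Subset n
  N v = tabulate (λ u → adj G v u)

  degree : Fin n → ℕ
  degree v = ∣ N v ∣

  Regular : ℕ → Set
  Regular r = ∀ v → degree v ≡ r

  data Walk : Fin n → Fin n → Set where
    here  : ∀ {v} → Walk v v
    there : ∀ {u w v} → adj G u w ≡ true → Walk w v → Walk u v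

  Connected : Set
  Connected = ∀ u v → Walk u v

  Total2Dominating : Subset n → Set
  Total2Dominating S = ∀ v → 2 ≤ ∣ N v ∩ S ∣

  Total2Coalition : Subset n → Subset n → Set
  Total2Coalition U W =
    (U ∩ W ≡ ⊥) × ¬ Total2Dominating U × ¬ Total2Dominating W
      × Total2Dominating (U ∪ W)

  -- A partition of V(G) into k (nonempty) classes is represented by a
  -- surjective class-assignment map f : Fin n → Fin k.
  class : {k : ℕ} → (Fin n → Fin k) → Fin k → Subset n
  class f i = tabulate (λ v → ⌊ f v ≟ i ⌋)

  IsPartition : {k : ℕ} → (Fin n → Fin k) → Set
  IsPartition f = Surjective _≡_ _≡_ f

  Total2CoalitionPartition : {k : ℕ} → (Fin n → Fin k) → Set
  Total2CoalitionPartition {k} f =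
    IsPartition f ×
    (∀ i → Σ[ j ∈ Fin k ] (j ≢ i × Total2Coalition (class f i) (class f j)))

  TC₂≡ : ℕ → Set
  TC₂≡ m =
    (Σ[ f ∈ (Fin n → Fin m) ] Total2CoalitionPartition f)
    × (∀ k (f : Fin n → Fin k) → Total2CoalitionPartition f → k ≤ m)

-- Lower bound: take a vertex v₀ with neighbours a, b, c and partition V(G) into {a}, {b}, {c}
-- and the rest R.  No class contains two neighbours of v₀, yet {x} ∪ R misses only two vertices,
-- so it contains at least two of the four neighbours of every vertex.
--
-- Upper bound: write c_v(i) = |N(v) ∩ Vᵢ|; for distinct classes these sum to at most 4.  Two
-- disjoint coalition pairs together with a fifth class are impossible: a neighbour of a vertex
-- of the fifth class would see 2 + 2 + 1 neighbours.  With five or more classes the coalition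
-- pairs therefore all meet, which forces them into a star centred at one class s; at a vertex
-- where s has at most one neighbour, the pair {s, t} still has two and three further classes
-- have at least one each, again five neighbours.

module Submission where

open import Defs renaming (sym to adj-sym)
open import Data.Bool using (Bool; true; if_then_else_)
open import Data.Bool.Properties using (T-≡)
open import Data.Empty using (⊥; ⊥-elim)
open import Data.Fin using (Fin; zero; suc; _≟_)
open import Data.Fin.Patterns using (0F; 1F; 2F; 3F)
open import Data.Fin.Properties using (all?; ¬∀⟶∃¬; injective⇒≤)
open import Data.Fin.Subset
  using (Subset; inside; outside; _∈_; _∉_; _⊆_; _∩_; _∪_; _─_; _-_; ∁; ⁅_⁆; ∣_∣; Nonempty)
  renaming (⊥ to ∅)
open import Data.Fin.Subset.Properties
  using (_∈?_; p⊆q⇒∣p∣≤∣q∣; p─q⊆p; ∣p∩q∣≤∣q∣; ∣⁅x⁆∣≡1; x∈⁅x⁆; x∈⁅y⁆⇒x≡y; x∉⁅y⁆⇒x≢y;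
         x∈p∩q⁺; x∈p∩q⁻; x∈p∪q⁺; x∉p⇒x∈∁p; x∈∁p⇒x∉p; x∈p∧x∉q⇒x∈p─q; x∈p∧x≢y⇒x∈p-y;
         x∈p⇒∣p-x∣<∣p∣; Empty-unique; ∩-distribˡ-∪; ∩-comm; ∪-comm)
open import Data.List using (List; []; _∷_; length; lookup; map)
import Data.List.Membership.Propositional as List
open import Data.List.Relation.Unary.All using (All; []; _∷_)
open import Data.List.Relation.Unary.All.Properties using (¬Any⇒All¬)
open import Data.List.Relation.Unary.AllPairs using (AllPairs; []; _∷_)
open import Data.List.Relation.Unary.Any using (index; any?)
open import Data.List.Relation.Unary.Any.Properties using (lookup-index)
open import Data.Nat using (ℕ; suc; _+_; _≤_; _<_; z≤n; s≤s)
open import Data.Nat.ListAction using (sum)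
open import Data.Nat.Properties hiding (_≟_)
open import Data.Product using (Σ-syntax; ∃; _×_; _,_; proj₁; proj₂)
open import Data.Sum using (inj₁; inj₂)
open import Data.Vec using (tabulate; _∷_; []; here; there)
open import Data.Vec.Properties using (lookup∘tabulate; []=⇒lookup; lookup⇒[]=)
open import Function.Bundles using (Equivalence)
open import Relation.Nullary using (¬_; does; yes; no; contradiction)
open import Relation.Nullary.Decidable using (dec-true; dec-false; isYes≗does; toWitness)
open import Relation.Binary.PropositionalEquality

private
  variable
    n : ℕ

∣p∪q∣≤∣p∣+∣q∣ : ∀ (p q : Subset n) → ∣ p ∪ q ∣ ≤ ∣ p ∣ + ∣ q ∣
∣p∪q∣≤∣p∣+∣q∣ []            []            = z≤n
∣p∪q∣≤∣p∣+∣q∣ (outside ∷ p) (outside ∷ q) = ∣p∪q∣≤∣p∣+∣q∣ p q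
∣p∪q∣≤∣p∣+∣q∣ (outside ∷ p) (inside  ∷ q) =
  subst (suc ∣ p ∪ q ∣ ≤_) (sym (+-suc ∣ p ∣ ∣ q ∣)) (s≤s (∣p∪q∣≤∣p∣+∣q∣ p q))
∣p∪q∣≤∣p∣+∣q∣ (inside  ∷ p) (outside ∷ q) = s≤s (∣p∪q∣≤∣p∣+∣q∣ p q)
∣p∪q∣≤∣p∣+∣q∣ (inside  ∷ p) (inside  ∷ q) =
  s≤s (≤-trans (∣p∪q∣≤∣p∣+∣q∣ p q) (+-monoʳ-≤ ∣ p ∣ (n≤1+n ∣ q ∣)))

∣p∩[q∪r]∣≤∣p∩q∣+∣p∩r∣ : ∀ (p q r : Subset n) → ∣ p ∩ (q ∪ r) ∣ ≤ ∣ p ∩ q ∣ + ∣ p ∩ r ∣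
∣p∩[q∪r]∣≤∣p∩q∣+∣p∩r∣ p q r =
  subst (λ s → ∣ s ∣ ≤ ∣ p ∩ q ∣ + ∣ p ∩ r ∣) (sym (∩-distribˡ-∪ p q r)) (∣p∪q∣≤∣p∣+∣q∣ (p ∩ q) (p ∩ r))

∣p∩q∣+∣p─q∣≡∣p∣ : ∀ (p q : Subset n) → ∣ p ∩ q ∣ + ∣ p ─ q ∣ ≡ ∣ p ∣
∣p∩q∣+∣p─q∣≡∣p∣ []            []            = refl
∣p∩q∣+∣p─q∣≡∣p∣ (outside ∷ p) (outside ∷ q) = ∣p∩q∣+∣p─q∣≡∣p∣ p q
∣p∩q∣+∣p─q∣≡∣p∣ (outside ∷ p) (inside  ∷ q) = ∣p∩q∣+∣p─q∣≡∣p∣ p q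
∣p∩q∣+∣p─q∣≡∣p∣ (inside  ∷ p) (outside ∷ q) =
  trans (+-suc ∣ p ∩ q ∣ ∣ p ─ q ∣) (cong suc (∣p∩q∣+∣p─q∣≡∣p∣ p q))
∣p∩q∣+∣p─q∣≡∣p∣ (inside  ∷ p) (inside  ∷ q) = cong suc (∣p∩q∣+∣p─q∣≡∣p∣ p q)

∣p∣≤∣p∩q∣+∣∁q∣ : ∀ (p q : Subset n) → ∣ p ∣ ≤ ∣ p ∩ q ∣ + ∣ ∁ q ∣
∣p∣≤∣p∩q∣+∣∁q∣ p q = ≤-trans (p⊆q⇒∣p∣≤∣q∣ split) (∣p∪q∣≤∣p∣+∣q∣ (p ∩ q) (∁ q))
  where
  split : p ⊆ p ∩ q ∪ ∁ q
  split {x} x∈p with x ∈? q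
  ... | yes x∈q = x∈p∪q⁺ (inj₁ (x∈p∩q⁺ (x∈p , x∈q)))
  ... | no  x∉q = x∈p∪q⁺ (inj₂ (x∉p⇒x∈∁p x∉q))

x∈p⇒0<∣p∣ : ∀ {p : Subset n} {x} → x ∈ p → 0 < ∣ p ∣
x∈p⇒0<∣p∣ {p = p} {x} x∈p =
  subst (_≤ ∣ p ∣) (∣⁅x⁆∣≡1 x) (p⊆q⇒∣p∣≤∣q∣ λ y∈⁅x⁆ → subst (_∈ p) (sym (x∈⁅y⁆⇒x≡y x y∈⁅x⁆)) x∈p)

0<∣p∣⇒Nonempty : ∀ {p : Subset n} → 0 < ∣ p ∣ → Nonempty p
0<∣p∣⇒Nonempty {p = inside  ∷ p} _ = zero , here
0<∣p∣⇒Nonempty {p = outside ∷ p} 0<∣p∣ with 0<∣p∣⇒Nonempty 0<∣p∣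
... | x , x∈p = suc x , there x∈p

x∈p─q⇒x∉q : ∀ {p q : Subset n} {x} → x ∈ p ─ q → x ∉ q
x∈p─q⇒x∉q {p = inside ∷ p} {outside ∷ q} here        ()
x∈p─q⇒x∉q {p = _      ∷ p} {_       ∷ q} (there x∈) (there x∈q) = x∈p─q⇒x∉q x∈ x∈q

∣p∣≤1+∣p-x∣ : ∀ (p : Subset n) x → ∣ p ∣ ≤ 1 + ∣ p - x ∣
∣p∣≤1+∣p-x∣ p x = begin
  ∣ p ∣                     ≡⟨ sym (∣p∩q∣+∣p─q∣≡∣p∣ p ⁅ x ⁆) ⟩
  ∣ p ∩ ⁅ x ⁆ ∣ + ∣ p - x ∣ ≤⟨ +-monoˡ-≤ ∣ p - x ∣ (≤-trans (∣p∩q∣≤∣q∣ p ⁅ x ⁆) (≤-reflexive (∣⁅x⁆∣≡1 x))) ⟩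
  1 + ∣ p - x ∣             ∎
  where open ≤-Reasoning

pick : ∀ {m} {p : Subset n} → suc m ≤ ∣ p ∣ → ∃ λ x → x ∈ p × m ≤ ∣ p - x ∣
pick {p = p} 1+m≤∣p∣ with 0<∣p∣⇒Nonempty (≤-trans (s≤s z≤n) 1+m≤∣p∣)
... | x , x∈p = x , x∈p , ≤-pred (≤-trans 1+m≤∣p∣ (∣p∣≤1+∣p-x∣ p x))

x∈p-y⇒x≢y : ∀ {p : Subset n} {x y} → x ∈ p - y → x ≢ y
x∈p-y⇒x≢y x∈p-y = x∉⁅y⁆⇒x≢y (x∈p─q⇒x∉q x∈p-y)

record DistinctTriple (p : Subset n) : Set where
  field
    a b c     : Fin n
    a∈p       : a ∈ p
    b∈p       : b ∈ p
    c∈p       : c ∈ p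
    b≢a       : b ≢ a
    c≢a       : c ≢ a
    c≢b       : c ≢ b

3≤∣p∣⇒DistinctTriple : ∀ {p : Subset n} → 3 ≤ ∣ p ∣ → DistinctTriple p
3≤∣p∣⇒DistinctTriple {p = p} 3≤∣p∣ with pick {p = p} 3≤∣p∣
... | a , a∈p , 2≤∣p-a∣ with pick {p = p - a} 2≤∣p-a∣
...   | b , b∈p-a , 1≤∣p-a-b∣ with pick {p = p - a - b} 1≤∣p-a-b∣
...     | c , c∈p-a-b , _ = record
  { a = a ; b = b ; c = c
  ; a∈p = a∈p
  ; b∈p = p─q⊆p p ⁅ a ⁆ b∈p-a
  ; c∈p = p─q⊆p p ⁅ a ⁆ c∈p-a
  ; b≢a = x∈p-y⇒x≢y b∈p-a
  ; c≢a = x∈p-y⇒x≢y c∈p-a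
  ; c≢b = x∈p-y⇒x≢y c∈p-a-b
  }
  where c∈p-a = p─q⊆p (p - a) ⁅ b ⁆ c∈p-a-b

∃∉ : ∀ {k} (xs : List (Fin k)) → length xs < k → ∃ λ e → e List.∉ xs
∃∉ {k} xs len<k with all? (λ e → any? (e ≟_) xs)
... | yes all∈ = contradiction (injective⇒≤ position-injective) (<⇒≱ len<k)
  where
  position-injective : ∀ {e e′} → index (all∈ e) ≡ index (all∈ e′) → e ≡ e′
  position-injective {e} {e′} eq =
    trans (lookup-index (all∈ e)) (trans (cong (lookup xs) eq) (sym (lookup-index (all∈ e′))))
... | no ¬all∈ = ¬∀⟶∃¬ k _ (λ e → any? (e ≟_) xs) ¬all∈

extend-distinct : ∀ {k} {xs : List (Fin k)} → AllPairs _≢_ xs → length xs < k →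
                  ∃ λ e → AllPairs _≢_ (e ∷ xs)
extend-distinct {xs = xs} distinct len<k with ∃∉ xs len<k
... | e , e∉xs = e , ¬Any⇒All¬ xs e∉xs ∷ distinct

-- count v i stands for |N(v) ∩ Vᵢ|, and partner i for a class forming a coalition with Vᵢ.
module CoalitionCounts
  {V : Set} {k : ℕ} (count : V → Fin k → ℕ)
  (partner : Fin k → Fin k) (partner-≢ : ∀ i → partner i ≢ i)
  (partner-covers : ∀ i v → 2 ≤ count v i + count v (partner i))
  (sparse : ∀ i → ∃ λ v → count v i ≤ 1)
  (hit : ∀ i → ∃ λ v → 1 ≤ count v i)
  (bounded : ∀ v {xs} → AllPairs _≢_ xs → sum (map (count v) xs) ≤ 4)
  where

  Covers : Fin k → Fin k → Set
  Covers i j = ∀ v → 2 ≤ count v i + count v j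

  Covers-sym : ∀ {i j} → Covers i j → Covers j i
  Covers-sym {i} {j} i~j v = subst (2 ≤_) (+-comm (count v i) (count v j)) (i~j v)

  Covers-partner : ∀ {i j} → partner i ≡ j → Covers i j
  Covers-partner {i} refl = partner-covers i

  module _ (5≤k : 5 ≤ k) where

    disjoint-covers : ∀ {a b l m} → AllPairs _≢_ (a ∷ b ∷ l ∷ m ∷ []) →
                      Covers a b → Covers l m → ⊥
    disjoint-covers {a} {b} {l} {m} distinct a~b l~m with extend-distinct distinct 5≤k
    ... | e , distinct′ with hit e
    ...   | w , 1≤e = <⇒≱ (≤-trans five≤ (≤-reflexive regroup)) (bounded w distinct′)
      where
      c : Fin k → ℕ
      c = count w
      five≤ : 5 ≤ c e + ((c a + c b) + (c l + c m))
      five≤ = +-mono-≤ 1≤e (+-mono-≤ (a~b w) (l~m w))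
      regroup : c e + ((c a + c b) + (c l + c m)) ≡ sum (map c (e ∷ a ∷ b ∷ l ∷ m ∷ []))
      regroup = cong (c e +_) (trans (+-assoc (c a) (c b) _)
                  (cong (λ x → c a + (c b + (c l + x))) (sym (+-identityʳ (c m)))))

    star-covers : ∀ {s t l} → AllPairs _≢_ (s ∷ t ∷ l ∷ []) → Covers s t → Covers s l → ⊥
    star-covers {s} {t} {l} stl@((s≢t ∷ s≢l ∷ []) ∷ (t≢l ∷ []) ∷ [] ∷ []) s~t s~l
      with extend-distinct stl (<⇒≤ 5≤k)
    ... | q , qstl with extend-distinct qstl 5≤k
    ...   | z , zqstl@((_ ∷ z≢stl) ∷ _) with sparse s
    ...     | v , s≤1 = <⇒≱ (≤-trans five≤ (≤-reflexive regroup)) (bounded v zqstl)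
      where
      covers-s : ∀ {x} → AllPairs _≢_ (x ∷ s ∷ t ∷ l ∷ []) → Covers s x
      covers-s {x} ((x≢s ∷ x≢t ∷ x≢l ∷ []) ∷ _) with partner x ≟ s | partner x ≟ t
      ... | yes px≡s | _        = Covers-sym (Covers-partner px≡s)
      ... | no  _    | yes px≡t = ⊥-elim (disjoint-covers
        ((s≢l ∷ ≢-sym x≢s ∷ s≢t ∷ []) ∷ (≢-sym x≢l ∷ ≢-sym t≢l ∷ []) ∷ (x≢t ∷ []) ∷ [] ∷ [])
        s~l (Covers-partner px≡t))
      ... | no  px≢s | no px≢t = ⊥-elim (disjoint-covers
        ((s≢t ∷ ≢-sym x≢s ∷ ≢-sym px≢s ∷ []) ∷ (≢-sym x≢t ∷ ≢-sym px≢t ∷ []) ∷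
         (≢-sym (partner-≢ x) ∷ []) ∷ [] ∷ [])
        s~t (Covers-partner refl))
      c : Fin k → ℕ
      c = count v
      at-least-one : ∀ {x} → Covers s x → 1 ≤ c x
      at-least-one {x} s~x = +-cancelˡ-≤ 1 1 (c x) (≤-trans (s~x v) (+-monoˡ-≤ (c x) s≤1))
      five≤ : 5 ≤ c z + (c q + ((c s + c t) + c l))
      five≤ = +-mono-≤ (at-least-one (covers-s (z≢stl ∷ stl)))
                (+-mono-≤ (at-least-one (covers-s qstl)) (+-mono-≤ (s~t v) (at-least-one s~l)))
      regroup : c z + (c q + ((c s + c t) + c l)) ≡ sum (map c (z ∷ q ∷ s ∷ t ∷ l ∷ []))
      regroup = cong (λ x → c z + (c q + x))
                  (trans (+-assoc (c s) (c t) (c l)) (cong (λ x → c s + (c t + x)) (sym (+-identityʳ (c l)))))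

    five-classes-absurd : ⊥
    five-classes-absurd with extend-distinct [] (≤-trans (s≤s z≤n) 5≤k)
    ... | i , _ with extend-distinct ((≢-sym (partner-≢ i) ∷ []) ∷ [] ∷ []) (≤-trans (s≤s (s≤s (s≤s z≤n))) 5≤k)
    ...   | l , ((l≢i ∷ l≢pi ∷ []) ∷ _) with partner l ≟ i | partner l ≟ partner i
    ...     | yes pl≡i | _ = star-covers
                ((≢-sym (partner-≢ i) ∷ ≢-sym l≢i ∷ []) ∷ (≢-sym l≢pi ∷ []) ∷ [] ∷ [])
                (Covers-partner refl) (Covers-sym (Covers-partner pl≡i))
    ...     | no _ | yes pl≡pi = star-covers
                ((partner-≢ i ∷ ≢-sym l≢pi ∷ []) ∷ (≢-sym l≢i ∷ []) ∷ [] ∷ [])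
                (Covers-sym (Covers-partner refl)) (Covers-sym (Covers-partner pl≡pi))
    ...     | no pl≢i | no pl≢pi = disjoint-covers
                ((≢-sym (partner-≢ i) ∷ ≢-sym l≢i ∷ ≢-sym pl≢i ∷ []) ∷ (≢-sym l≢pi ∷ ≢-sym pl≢pi ∷ []) ∷
                 (≢-sym (partner-≢ l) ∷ []) ∷ [] ∷ [])
                (Covers-partner refl) (Covers-partner refl)

  classes≤4 : k ≤ 4
  classes≤4 with k ≤? 4
  ... | yes k≤4 = k≤4
  ... | no  k≰4 = ⊥-elim (five-classes-absurd (≰⇒> k≰4))

∈-tabulate⁺ : ∀ {g : Fin n → Bool} {x} → g x ≡ true → x ∈ tabulate g
∈-tabulate⁺ {g = g} {x} gx≡true = lookup⇒[]= x (tabulate g) (trans (lookup∘tabulate g x) gx≡true)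

∈-tabulate⁻ : ∀ {g : Fin n → Bool} {x} → x ∈ tabulate g → g x ≡ true
∈-tabulate⁻ {g = g} {x} x∈ = trans (sym (lookup∘tabulate g x)) ([]=⇒lookup x∈)

module _ {n : ℕ} (G : Graph n) where

  ∈-N⁺ : ∀ {v u} → adj G v u ≡ true → u ∈ N G v
  ∈-N⁺ = ∈-tabulate⁺

  ∈-N⁻ : ∀ {v u} → u ∈ N G v → adj G v u ≡ true
  ∈-N⁻ = ∈-tabulate⁻

  ∈-N-sym : ∀ {v u} → u ∈ N G v → v ∈ N G u
  ∈-N-sym {v} {u} u∈Nv = ∈-N⁺ (trans (adj-sym G u v) (∈-N⁻ u∈Nv))

  ∈-N-irrefl : ∀ {v u} → u ∈ N G v → v ≢ u
  ∈-N-irrefl {v} u∈Nv refl with trans (sym (∈-N⁻ u∈Nv)) (irrefl G v)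
  ... | ()

  Total2Coalition-sym : ∀ {U W} → Total2Coalition G U W → Total2Coalition G W U
  Total2Coalition-sym {U} {W} (disjoint , ¬U , ¬W , U∪W) =
    trans (∩-comm W U) disjoint , ¬W , ¬U , subst (Total2Dominating G) (∪-comm U W) U∪W

  module _ {k : ℕ} (f : Fin n → Fin k) where

    ∈-class⁺ : ∀ {u i} → f u ≡ i → u ∈ class G f i
    ∈-class⁺ {u} {i} fu≡i = ∈-tabulate⁺ (trans (isYes≗does (f u ≟ i)) (dec-true (f u ≟ i) fu≡i))

    ∈-class⁻ : ∀ {u i} → u ∈ class G f i → f u ≡ i
    ∈-class⁻ {u} {i} u∈ = toWitness (Equivalence.from T-≡ (∈-tabulate⁻ u∈))

    class-disjoint : ∀ {i j} → i ≢ j → class G f i ∩ class G f j ≡ ∅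
    class-disjoint {i} {j} i≢j = Empty-unique λ (u , u∈) →
      let (u∈i , u∈j) = x∈p∩q⁻ (class G f i) (class G f j) u∈
      in i≢j (trans (sym (∈-class⁻ u∈i)) (∈-class⁻ u∈j))

    ∑∣p∩class∣≤∣p∣ : ∀ {xs} → AllPairs _≢_ xs → ∀ p → sum (map (λ i → ∣ p ∩ class G f i ∣) xs) ≤ ∣ p ∣
    ∑∣p∩class∣≤∣p∣ []                         _ = z≤n
    ∑∣p∩class∣≤∣p∣ {x ∷ xs} (x≢xs ∷ distinct) p = begin
      ∣ p ∩ C x ∣ + sum (map (λ i → ∣ p ∩ C i ∣) xs)
        ≤⟨ +-monoʳ-≤ ∣ p ∩ C x ∣ (≤-trans (shrink x≢xs) (∑∣p∩class∣≤∣p∣ distinct (p ─ C x))) ⟩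
      ∣ p ∩ C x ∣ + ∣ p ─ C x ∣
        ≡⟨ ∣p∩q∣+∣p─q∣≡∣p∣ p (C x) ⟩
      ∣ p ∣ ∎
      where
      open ≤-Reasoning
      C : Fin k → Subset n
      C = class G f
      outside-C-x : ∀ {y} → x ≢ y → p ∩ C y ⊆ (p ─ C x) ∩ C y
      outside-C-x {y} x≢y u∈ =
        let (u∈p , u∈Cy) = x∈p∩q⁻ p (C y) u∈
        in x∈p∩q⁺ (x∈p∧x∉q⇒x∈p─q u∈p (λ u∈Cx → x≢y (trans (sym (∈-class⁻ u∈Cx)) (∈-class⁻ u∈Cy))) , u∈Cy)
      shrink : ∀ {ys} → All (x ≢_) ys →
               sum (map (λ i → ∣ p ∩ C i ∣) ys) ≤ sum (map (λ i → ∣ (p ─ C x) ∩ C i ∣) ys)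
      shrink []            = z≤n
      shrink (x≢y ∷ x≢ys) = +-mono-≤ (p⊆q⇒∣p∣≤∣q∣ (outside-C-x x≢y)) (shrink x≢ys)

  has-neighbour : ∀ {r} → Regular G (suc r) → ∀ u → ∃ λ w → u ∈ N G w
  has-neighbour regular u with 0<∣p∣⇒Nonempty (subst (0 <_) (sym (regular u)) (s≤s z≤n))
  ... | w , w∈Nu = w , ∈-N-sym w∈Nu

  ¬Total2Dominating : ∀ {S} v → ∣ N G v ∩ S ∣ ≤ 1 → ¬ Total2Dominating G S
  ¬Total2Dominating v ≤1 dominating = <⇒≱ (dominating v) ≤1

  ∣∁S∣≤⇒Total2Dominating : ∀ {r S} → Regular G (2 + r) → ∣ ∁ S ∣ ≤ r → Total2Dominating G S
  ∣∁S∣≤⇒Total2Dominating {r} {S} regular ∣∁S∣≤r v = +-cancelʳ-≤ r 2 _ (begin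
    2 + r                      ≡⟨ sym (regular v) ⟩
    ∣ N G v ∣                  ≤⟨ ∣p∣≤∣p∩q∣+∣∁q∣ (N G v) S ⟩
    ∣ N G v ∩ S ∣ + ∣ ∁ S ∣    ≤⟨ +-monoʳ-≤ _ ∣∁S∣≤r ⟩
    ∣ N G v ∩ S ∣ + r          ∎)
    where open ≤-Reasoning

  module _ (4-regular : Regular G 4) where

    Total2CoalitionPartition⇒≤4 : ∀ k (f : Fin n → Fin k) → Total2CoalitionPartition G f → k ≤ 4
    Total2CoalitionPartition⇒≤4 k f (surjective , coalition) =
      CoalitionCounts.classes≤4 count partner partner-≢ partner-covers sparse hit bounded
      where
      count : Fin n → Fin k → ℕ
      count v i = ∣ N G v ∩ class G f i ∣
      partner : Fin k → Fin k
      partner i = proj₁ (coalition i)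
      partner-≢ : ∀ i → partner i ≢ i
      partner-≢ i = proj₁ (proj₂ (coalition i))
      partner-covers : ∀ i v → 2 ≤ count v i + count v (partner i)
      partner-covers i v with coalition i
      ... | _ , _ , _ , _ , _ , dominating = ≤-trans (dominating v) (∣p∩[q∪r]∣≤∣p∩q∣+∣p∩r∣ (N G v) _ _)
      sparse : ∀ i → ∃ λ v → count v i ≤ 1
      sparse i with coalition i
      ... | _ , _ , _ , ¬dominating , _ with ¬∀⟶∃¬ n _ (λ v → 2 ≤? count v i) ¬dominating
      ...   | v , count<2 = v , ≤-pred (≰⇒> count<2)
      hit : ∀ i → ∃ λ v → 1 ≤ count v i
      hit i with surjective i
      ... | u , fu≡i with has-neighbour 4-regular u
      ...   | w , u∈Nw = w , x∈p⇒0<∣p∣ (x∈p∩q⁺ (u∈Nw , ∈-class⁺ f (fu≡i refl)))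
      bounded : ∀ v {xs} → AllPairs _≢_ xs → sum (map (count v) xs) ≤ 4
      bounded v distinct = ≤-trans (∑∣p∩class∣≤∣p∣ f distinct (N G v)) (≤-reflexive (4-regular v))

module SingletonPartition {n : ℕ} (G : Graph n) (4-regular : Regular G 4) (v₀ : Fin n)
  (neighbours : DistinctTriple (N G v₀)) where

  open DistinctTriple neighbours

  -- v₀ lies in the rest class 3F, which makes point a section of assign.
  point : Fin 4 → Fin n
  point 0F = a
  point 1F = b
  point 2F = c
  point 3F = v₀

  assign : Fin n → Fin 4
  assign u = if does (u ≟ a) then 0F else if does (u ≟ b) then 1F else if does (u ≟ c) then 2F else 3F

  assign∘point : ∀ j → assign (point j) ≡ j
  assign∘point 0F rewrite dec-true (a ≟ a) refl = refl
  assign∘point 1F rewrite dec-false (b ≟ a) b≢a | dec-true (b ≟ b) refl = refl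
  assign∘point 2F rewrite dec-false (c ≟ a) c≢a | dec-false (c ≟ b) c≢b | dec-true (c ≟ c) refl = refl
  assign∘point 3F rewrite dec-false (v₀ ≟ a) (∈-N-irrefl G a∈p) | dec-false (v₀ ≟ b) (∈-N-irrefl G b∈p)
                        | dec-false (v₀ ≟ c) (∈-N-irrefl G c∈p) = refl

  point∘assign : ∀ u → assign u ≢ 3F → point (assign u) ≡ u
  point∘assign u with u ≟ a | u ≟ b | u ≟ c
  ... | yes u≡a | _       | _       = λ _ → sym u≡a
  ... | no _    | yes u≡b | _       = λ _ → sym u≡b
  ... | no _    | no _    | yes u≡c = λ _ → sym u≡c
  ... | no _    | no _    | no _    = λ ≢3F → ⊥-elim (≢3F refl)

  C : Fin 4 → Subset n
  C = class G assign

  ∈C⇒≡point : ∀ {u j} → u ∈ C j → j ≢ 3F → u ≡ point j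
  ∈C⇒≡point {u} u∈Cj j≢3F with ∈-class⁻ G assign u∈Cj
  ... | refl = sym (point∘assign u j≢3F)

  point∈N : ∀ j → j ≢ 3F → point j ∈ N G v₀
  point∈N 0F _ = a∈p
  point∈N 1F _ = b∈p
  point∈N 2F _ = c∈p
  point∈N 3F 3F≢3F = ⊥-elim (3F≢3F refl)

  ∣C∣≤1 : ∀ j → j ≢ 3F → ∣ C j ∣ ≤ 1
  ∣C∣≤1 j j≢3F = ≤-trans (p⊆q⇒∣p∣≤∣q∣ C⊆⁅point⁆) (≤-reflexive (∣⁅x⁆∣≡1 (point j)))
    where
    C⊆⁅point⁆ : C j ⊆ ⁅ point j ⁆
    C⊆⁅point⁆ u∈Cj = subst (_∈ ⁅ point j ⁆) (sym (∈C⇒≡point u∈Cj j≢3F)) (x∈⁅x⁆ (point j))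

  ∣N∩C3F∣≤1 : ∣ N G v₀ ∩ C 3F ∣ ≤ 1
  ∣N∩C3F∣≤1 = +-cancelʳ-≤ 3 (count 3F) 1 (begin
    count 3F + 3
      ≤⟨ +-monoʳ-≤ (count 3F) (+-mono-≤ (hit 0F (λ ())) (+-mono-≤ (hit 1F (λ ())) (+-mono-≤ (hit 2F (λ ())) z≤n))) ⟩
    count 3F + (count 0F + (count 1F + (count 2F + 0)))
      ≤⟨ ∑∣p∩class∣≤∣p∣ G assign distinct (N G v₀) ⟩
    ∣ N G v₀ ∣
      ≡⟨ 4-regular v₀ ⟩
    4 ∎)
    where
    open ≤-Reasoning
    count : Fin 4 → ℕ
    count j = ∣ N G v₀ ∩ C j ∣
    hit : ∀ j → j ≢ 3F → 1 ≤ count j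
    hit j j≢3F = x∈p⇒0<∣p∣ (x∈p∩q⁺ (point∈N j j≢3F , ∈-class⁺ G assign (assign∘point j)))
    distinct : AllPairs _≢_ (3F ∷ 0F ∷ 1F ∷ 2F ∷ [])
    distinct = ((λ ()) ∷ (λ ()) ∷ (λ ()) ∷ []) ∷ ((λ ()) ∷ (λ ()) ∷ []) ∷ ((λ ()) ∷ []) ∷ [] ∷ []

  abc : Subset n
  abc = ⁅ a ⁆ ∪ ⁅ b ⁆ ∪ ⁅ c ⁆

  ∣abc∣≤3 : ∣ abc ∣ ≤ 3
  ∣abc∣≤3 = ≤-trans (∣p∪q∣≤∣p∣+∣q∣ ⁅ a ⁆ (⁅ b ⁆ ∪ ⁅ c ⁆))
            (+-mono-≤ (≤-reflexive (∣⁅x⁆∣≡1 a))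
              (≤-trans (∣p∪q∣≤∣p∣+∣q∣ ⁅ b ⁆ ⁅ c ⁆) (≤-reflexive (cong₂ _+_ (∣⁅x⁆∣≡1 b) (∣⁅x⁆∣≡1 c)))))

  point∈abc : ∀ j → j ≢ 3F → point j ∈ abc
  point∈abc 0F _ = x∈p∪q⁺ (inj₁ (x∈⁅x⁆ a))
  point∈abc 1F _ = x∈p∪q⁺ (inj₂ (x∈p∪q⁺ (inj₁ (x∈⁅x⁆ b))))
  point∈abc 2F _ = x∈p∪q⁺ (inj₂ (x∈p∪q⁺ (inj₂ (x∈⁅x⁆ c))))
  point∈abc 3F 3F≢3F = ⊥-elim (3F≢3F refl)

  ∁[C∪C3F]⊆abc-point : ∀ i → ∁ (C i ∪ C 3F) ⊆ abc - point i
  ∁[C∪C3F]⊆abc-point i {u} u∈∁ = x∈p∧x≢y⇒x∈p-y u∈abc u≢point-i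
    where
    u∉C : u ∉ C i ∪ C 3F
    u∉C = x∈∁p⇒x∉p u∈∁
    assign-u≢i : assign u ≢ i
    assign-u≢i eq = u∉C (x∈p∪q⁺ (inj₁ (∈-class⁺ G assign eq)))
    assign-u≢3F : assign u ≢ 3F
    assign-u≢3F eq = u∉C (x∈p∪q⁺ (inj₂ (∈-class⁺ G assign eq)))
    u∈abc : u ∈ abc
    u∈abc = subst (_∈ abc) (point∘assign u assign-u≢3F) (point∈abc (assign u) assign-u≢3F)
    u≢point-i : u ≢ point i
    u≢point-i u≡point-i = assign-u≢i (trans (cong assign u≡point-i) (assign∘point i))

  ∣∁[C∪C3F]∣≤2 : ∀ i → i ≢ 3F → ∣ ∁ (C i ∪ C 3F) ∣ ≤ 2
  ∣∁[C∪C3F]∣≤2 i i≢3F = ≤-pred (begin-strict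
    ∣ ∁ (C i ∪ C 3F) ∣  ≤⟨ p⊆q⇒∣p∣≤∣q∣ (∁[C∪C3F]⊆abc-point i) ⟩
    ∣ abc - point i ∣     <⟨ x∈p⇒∣p-x∣<∣p∣ (point∈abc i i≢3F) ⟩
    ∣ abc ∣               ≤⟨ ∣abc∣≤3 ⟩
    3                   ∎)
    where open ≤-Reasoning

  coalition-with-rest : ∀ i → i ≢ 3F → Total2Coalition G (C i) (C 3F)
  coalition-with-rest i i≢3F =
    class-disjoint G assign i≢3F ,
    ¬Total2Dominating G v₀ (≤-trans (∣p∩q∣≤∣q∣ (N G v₀) (C i)) (∣C∣≤1 i i≢3F)) ,
    ¬Total2Dominating G v₀ ∣N∩C3F∣≤1 ,
    ∣∁S∣≤⇒Total2Dominating G 4-regular (∣∁[C∪C3F]∣≤2 i i≢3F)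

  coalition : ∀ i → Σ[ j ∈ Fin 4 ] (j ≢ i × Total2Coalition G (C i) (C j))
  coalition i with i ≟ 3F
  ... | yes refl = 0F , (λ ()) , Total2Coalition-sym G (coalition-with-rest 0F (λ ()))
  ... | no i≢3F  = 3F , ≢-sym i≢3F , coalition-with-rest i i≢3F

  total2CoalitionPartition : Total2CoalitionPartition G assign
  total2CoalitionPartition = (λ j → point j , λ { refl → assign∘point j }) , coalition

proposition3p7 : (n : ℕ) (G : Graph n) → 0 < n → Connected G → Regular G 4
                 → TC₂≡ G 4
proposition3p7 (suc n) G _ _ 4-regular =
  (assign , total2CoalitionPartition) , Total2CoalitionPartition⇒≤4 G 4-regular
  where
  3≤∣N∣ : 3 ≤ ∣ N G zero ∣
  3≤∣N∣ = subst (3 ≤_) (sym (4-regular zero)) (n≤1+n 3)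
  open SingletonPartition G 4-regular zero (3≤∣p∣⇒DistinctTriple 3≤∣N∣)
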